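{- Let $p$ be a prime number, let $a\geq1$, $b\geq0$, $c\geq0$ be integers, and let $f^{(1)},\dots,f^{(a+b)},g^{(1)},\dots,g^{(a+c)}\in\mathbb{Z}[x]$ be monic polynomials. For $i\in\{1,\dots,a\}$ let $h^{(i)}=f^{(i)}$ if $\deg f^{(i)}<\deg g^{(i)}$ and $h^{(i)}=g^{(i)}$ if $\deg f^{(i)}\geq\deg g^{(i)}$. Suppose that $|R(f^{(i)},g^{(j)})|=1$ for all $i\neq j$ and for all $i=j\geq a+1$ (for which both polynomials are defined), and that $(f^{(i)},g^{(i)})=(p,h^{(i)})$ as ideals of $\mathbb{Z}[x]$ for $i\in\{1,\dots,a\}$. Then $$\Bigl(\prod_{i=1}^{a+b}f^{(i)},\ \prod_{j=1}^{a+c}g^{(j)}\Bigr)=\Bigl(p,\ \prod_{i=1}^{a}h^{(i)}\Bigr)$$ as ideals of $\mathbb{Z}[x]$.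
   Context: The resultant $R(f,g)$ of $f=\sum_{i=0}^m f_ix^i$, $g=\sum_{j=0}^n g_jx^j$ (with $m+n\geq1$) is $\det A(f,g)$, where $A(f,g)$ is the $(m+n)\times(m+n)$ matrix defined by $(f,xf,\dots,x^{n-1}f,g,xg,\dots,x^{m-1}g)=(1,x,\dots,x^{m+n-1})\cdot A(f,g)$; if $m+n=0$, $R(f,g)=1$. For monic $f,g$ with roots $a_i$ and $b_j$, $R(f,g)=\prod_{i,j}(a_i-b_j)$. -}

module Defs where

open import Data.Nat as ℕ using (ℕ; zero; suc; _≤_; _<_; _≤?_; _<?_; _∸_)
open import Data.Integer using (ℤ; +_; _+_; _*_; -_; ∣_∣)
open import Data.Fin using (Fin; zero; suc; toℕ; punchIn)
open import Data.List using (List; []; _∷_; _++_; [_]; map; length)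
open import Data.Product using (Σ; ∃; _,_; _×_)
open import Relation.Nullary using (yes; no)
open import Relation.Binary.PropositionalEquality using (_≡_)

-- Polynomials in ℤ[x] as coefficient lists, lowest degree first.
-- Trailing zeros are allowed; equality of polynomials is coefficientwise.
Poly : Set
Poly = List ℤ

coeff : Poly → ℕ → ℤ
coeff []       _       = + 0
coeff (a ∷ _)  zero    = a
coeff (_ ∷ as) (suc k) = coeff as k

_≈P_ : Poly → Poly → Set
f ≈P g = ∀ k → coeff f k ≡ coeff g k

_+P_ : Poly → Poly → Poly
[]       +P q        = q
(a ∷ as) +P []       = a ∷ as
(a ∷ as) +P (b ∷ bs) = (a + b) ∷ (as +P bs)

_*P_ : Poly → Poly → Poly
[]       *P q = []
(a ∷ as) *P q = map (a *_) q +P (+ 0 ∷ (as *P q))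

const : ℤ → Poly
const c = c ∷ []

Monic : Poly → Set
Monic f = Σ (List ℤ) λ xs → f ≡ xs ++ [ + 1 ]

-- degree (correct for monic polynomials, whose list has no trailing zeros)
deg : Poly → ℕ
deg f = length f ∸ 1

prodP : ∀ {n} → (Fin n → Poly) → Poly
prodP {zero}  F = const (+ 1)
prodP {suc n} F = F zero *P prodP (λ i → F (suc i))

sumFin : ∀ {n} → (Fin n → ℤ) → ℤ
sumFin {zero}  F = + 0
sumFin {suc n} F = F zero + sumFin (λ i → F (suc i))

signℤ : ℕ → ℤ
signℤ zero          = + 1
signℤ (suc zero)    = - (+ 1)
signℤ (suc (suc k)) = signℤ k

det : ∀ {n} → (Fin n → Fin n → ℤ) → ℤ
det {zero}  M = + 1
det {suc n} M =
  sumFin (λ j → signℤ (toℕ j) * (M zero j * det (λ r c → M (suc r) (punchIn j c))))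

-- coefficient of x^r in x^k · f
shiftCoeff : Poly → ℕ → ℕ → ℤ
shiftCoeff f k r with k ≤? r
... | yes _ = coeff f (r ∸ k)
... | no  _ = + 0

-- Sylvester matrix A(f,g) with m = deg f, n = deg g: entry (row r, column c);
-- columns c < n are x^c f, columns n + k (k < m) are x^k g.
sylvester : (f g : Poly) → Fin (deg f ℕ.+ deg g) → Fin (deg f ℕ.+ deg g) → ℤ
sylvester f g r c with toℕ c <? deg g
... | yes _ = shiftCoeff f (toℕ c) (toℕ r)
... | no  _ = shiftCoeff g (toℕ c ∸ deg g) (toℕ r)

-- resultant R(f,g) = det A(f,g)  (= 1 when deg f + deg g = 0)
resultant : Poly → Poly → ℤ
resultant f g = det (sylvester f g)

_∈⟨_,_⟩ : Poly → Poly → Poly → Set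
h ∈⟨ u , v ⟩ = ∃ λ s → ∃ λ t → ((s *P u) +P (t *P v)) ≈P h

IdealEq : Poly → Poly → Poly → Poly → Set
IdealEq u v u' v' = (∀ h → h ∈⟨ u , v ⟩ → h ∈⟨ u' , v' ⟩)
                  × (∀ h → h ∈⟨ u' , v' ⟩ → h ∈⟨ u , v ⟩)

chooseH : Poly → Poly → Poly
chooseH f g with deg f <? deg g
... | yes _ = f
... | no  _ = g

{-# OPTIONS --safe #-}

-- If R(f, g) = ±1 then (f, g) = (1): weighting the Sylvester columns x^k f and x^k g by the
-- cofactors of the first row gives the constant R(f, g), because every other row contributes a
-- determinant with a repeated row.
-- The rest is ideal arithmetic in a commutative ring.  If (u, V) = (U, v) = (1), the cross
-- products uV and vU lie in (uU, vV), so (uU, vV) contains the product ideal (u, v)(U, V).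
-- Hence (u, v) = (p, h) and (U, V) = (p, H) give (uU, vV) = (p, hH): ⊆ since uU and vV lie in
-- (p, h)(p, H); ⊇ since hH lies in (u, v)(U, V), and so does p = p(aU + bv) for aU + bv = 1.
-- Induction on a splits off one pair f⁽ⁱ⁾, g⁽ⁱ⁾ at a time; for a = 0 both ideals are (1).

module Submission where

open import Defs

open import Level using (0ℓ; _⊔_)
open import Algebra.Bundles using (CommutativeRing)
open import Data.Product using (∃₂; _×_; _,_)

module TwoGeneratorIdeals {c ℓ} (R : CommutativeRing c ℓ) where

  open CommutativeRing R
  open import Algebra.Solver.Ring.NaturalCoefficients.Default commutativeSemiring
    using (solve; _:=_; _:+_; _:*_)

  infix 4 _∈⦅_,_⦆ ⦅_,_⦆⊆⦅_,_⦆ ⦅_,_⦆≐⦅_,_⦆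

  _∈⦅_,_⦆ : Carrier → Carrier → Carrier → Set (c ⊔ ℓ)
  x ∈⦅ u , v ⦆ = ∃₂ λ s t → s * u + t * v ≈ x

  ⦅_,_⦆⊆⦅_,_⦆ : Carrier → Carrier → Carrier → Carrier → Set (c ⊔ ℓ)
  ⦅ u , v ⦆⊆⦅ u′ , v′ ⦆ = ∀ x → x ∈⦅ u , v ⦆ → x ∈⦅ u′ , v′ ⦆

  ⦅_,_⦆≐⦅_,_⦆ : Carrier → Carrier → Carrier → Carrier → Set (c ⊔ ℓ)
  ⦅ u , v ⦆≐⦅ u′ , v′ ⦆ = ⦅ u , v ⦆⊆⦅ u′ , v′ ⦆ × ⦅ u′ , v′ ⦆⊆⦅ u , v ⦆

  Comaximal : Carrier → Carrier → Set (c ⊔ ℓ)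
  Comaximal u v = 1# ∈⦅ u , v ⦆

  module _ {u v : Carrier} where

    ∈-resp-≈ : ∀ {x y} → x ≈ y → x ∈⦅ u , v ⦆ → y ∈⦅ u , v ⦆
    ∈-resp-≈ x≈y (s , t , eq) = s , t , trans eq x≈y

    ∈-swap : ∀ {x} → x ∈⦅ u , v ⦆ → x ∈⦅ v , u ⦆
    ∈-swap (s , t , eq) = t , s , trans (+-comm (t * v) (s * u)) eq

    multiple-∈₁ : ∀ w → w * u ∈⦅ u , v ⦆
    multiple-∈₁ w = w , 0# , trans (+-congˡ (zeroˡ v)) (+-identityʳ (w * u))

    generator-∈₁ : u ∈⦅ u , v ⦆
    generator-∈₁ = ∈-resp-≈ (*-identityˡ u) (multiple-∈₁ 1#)

    ∈-+ : ∀ {x y} → x ∈⦅ u , v ⦆ → y ∈⦅ u , v ⦆ → x + y ∈⦅ u , v ⦆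
    ∈-+ (s , t , eq) (s′ , t′ , eq′) = s + s′ , t + t′ , trans (regroup s s′ t t′ u v) (+-cong eq eq′)
      where
      regroup : ∀ s s′ t t′ u v → (s + s′) * u + (t + t′) * v ≈ (s * u + t * v) + (s′ * u + t′ * v)
      regroup = solve 6 (λ s s′ t t′ u v →
        (s :+ s′) :* u :+ (t :+ t′) :* v := (s :* u :+ t :* v) :+ (s′ :* u :+ t′ :* v)) refl

    ∈-*ˡ : ∀ w {x} → x ∈⦅ u , v ⦆ → w * x ∈⦅ u , v ⦆
    ∈-*ˡ w (s , t , eq) = w * s , w * t , trans (regroup w s t u v) (*-congˡ eq)
      where
      regroup : ∀ w s t u v → (w * s) * u + (w * t) * v ≈ w * (s * u + t * v)
      regroup = solve 5 (λ w s t u v → (w :* s) :* u :+ (w :* t) :* v := w :* (s :* u :+ t :* v)) refl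

    ∈-scaleˡ : ∀ w {x} → x ∈⦅ u , v ⦆ → w * x ∈⦅ w * u , w * v ⦆
    ∈-scaleˡ w (s , t , eq) = s , t , trans (regroup w s t u v) (*-congˡ eq)
      where
      regroup : ∀ w s t u v → s * (w * u) + t * (w * v) ≈ w * (s * u + t * v)
      regroup = solve 5 (λ w s t u v → s :* (w :* u) :+ t :* (w :* v) := w :* (s :* u :+ t :* v)) refl

    ∈-scaleʳ : ∀ w {x} → x ∈⦅ u , v ⦆ → x * w ∈⦅ u * w , v * w ⦆
    ∈-scaleʳ w (s , t , eq) = s , t , trans (regroup w s t u v) (*-congʳ eq)
      where
      regroup : ∀ w s t u v → s * (u * w) + t * (v * w) ≈ (s * u + t * v) * w
      regroup = solve 5 (λ w s t u v → s :* (u :* w) :+ t :* (v :* w) := (s :* u :+ t :* v) :* w) refl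

    comaximal⇒∈ : Comaximal u v → ∀ x → x ∈⦅ u , v ⦆
    comaximal⇒∈ 1∈ x = ∈-resp-≈ (*-identityʳ x) (∈-*ˡ x 1∈)

  multiple-∈₂ : ∀ {u v} w → w * v ∈⦅ u , v ⦆
  multiple-∈₂ w = ∈-swap (multiple-∈₁ w)

  generator-∈₂ : ∀ {u v} → v ∈⦅ u , v ⦆
  generator-∈₂ = ∈-swap generator-∈₁

  ⊆-generators : ∀ {u v u′ v′} → u ∈⦅ u′ , v′ ⦆ → v ∈⦅ u′ , v′ ⦆ → ⦅ u , v ⦆⊆⦅ u′ , v′ ⦆
  ⊆-generators u∈ v∈ x (s , t , eq) = ∈-resp-≈ eq (∈-+ (∈-*ˡ s u∈) (∈-*ˡ t v∈))

  comaximal-≐ : ∀ {u v u′ v′} → Comaximal u v → Comaximal u′ v′ → ⦅ u , v ⦆≐⦅ u′ , v′ ⦆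
  comaximal-≐ uv u′v′ = (λ x _ → comaximal⇒∈ u′v′ x) , (λ x _ → comaximal⇒∈ uv x)

  ∈-*-sharedGenerator : ∀ {p h H x y} → x ∈⦅ p , h ⦆ → y ∈⦅ p , H ⦆ → x * y ∈⦅ p , h * H ⦆
  ∈-*-sharedGenerator {p} {h} {H} {x} {y} x∈ y∈ = ⊆-generators py∈ hy∈ (x * y) (∈-scaleʳ y x∈)
    where
    py∈ : p * y ∈⦅ p , h * H ⦆
    py∈ = ∈-resp-≈ (*-comm y p) (multiple-∈₁ y)
    hy∈ : h * y ∈⦅ p , h * H ⦆
    hy∈ = ⊆-generators (multiple-∈₁ h) generator-∈₂ (h * y) (∈-scaleˡ h y∈)

  comaximal-*ʳ : ∀ {u w W} → Comaximal u w → Comaximal u W → Comaximal u (w * W)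
  comaximal-*ʳ uw uW = ∈-resp-≈ (*-identityˡ 1#) (∈-*-sharedGenerator uw uW)

  cross-∈ : ∀ {u v U V} → Comaximal u V → v * U ∈⦅ u * U , v * V ⦆
  cross-∈ {u} {v} {U} {V} uV = ∈-resp-≈ (*-identityʳ (v * U))
    (⊆-generators vUu∈ vUV∈ ((v * U) * 1#) (∈-scaleˡ (v * U) uV))
    where
    vUu∈ : (v * U) * u ∈⦅ u * U , v * V ⦆
    vUu∈ = ∈-resp-≈ (solve 3 (λ u v U → v :* (u :* U) := (v :* U) :* u) refl u v U) (multiple-∈₁ v)
    vUV∈ : (v * U) * V ∈⦅ u * U , v * V ⦆
    vUV∈ = ∈-resp-≈ (solve 3 (λ v U V → U :* (v :* V) := (v :* U) :* V) refl v U V) (multiple-∈₂ U)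

  product-∈ : ∀ {u v U V x y} → Comaximal u V → Comaximal U v →
    x ∈⦅ u , v ⦆ → y ∈⦅ U , V ⦆ → x * y ∈⦅ u * U , v * V ⦆
  product-∈ {u} {v} {U} {V} {x} {y} uV Uv x∈ y∈ = ⊆-generators xU∈ xV∈ (x * y) (∈-scaleˡ x y∈)
    where
    uV∈ : u * V ∈⦅ u * U , v * V ⦆
    uV∈ = ∈-swap (cross-∈ (∈-swap Uv))
    xU∈ : x * U ∈⦅ u * U , v * V ⦆
    xU∈ = ⊆-generators generator-∈₁ (cross-∈ uV) (x * U) (∈-scaleʳ U x∈)
    xV∈ : x * V ∈⦅ u * U , v * V ⦆
    xV∈ = ⊆-generators uV∈ generator-∈₂ (x * V) (∈-scaleʳ V x∈)

  ≐-* : ∀ {u v U V p h H} → ⦅ u , v ⦆≐⦅ p , h ⦆ → ⦅ U , V ⦆≐⦅ p , H ⦆ →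
    Comaximal u V → Comaximal U v → ⦅ u * U , v * V ⦆≐⦅ p , h * H ⦆
  ≐-* {u} {v} {U} {V} {p} {h} {H} (uv⊆ph , ph⊆uv) (UV⊆pH , pH⊆UV) uV Uv =
    ⊆-generators (∈-*-sharedGenerator (uv⊆ph u generator-∈₁) (UV⊆pH U generator-∈₁))
                 (∈-*-sharedGenerator (uv⊆ph v generator-∈₂) (UV⊆pH V generator-∈₂)) ,
    ⊆-generators p∈ (product-∈ uV Uv (ph⊆uv h generator-∈₂) (pH⊆UV H generator-∈₂))
    where
    pU∈ : p * U ∈⦅ u * U , v * V ⦆
    pU∈ = product-∈ uV Uv (ph⊆uv p generator-∈₁) generator-∈₁
    pv∈ : p * v ∈⦅ u * U , v * V ⦆
    pv∈ = ∈-resp-≈ (*-comm v p) (product-∈ uV Uv generator-∈₂ (pH⊆UV p generator-∈₁))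
    p∈ : p ∈⦅ u * U , v * V ⦆
    p∈ = ∈-resp-≈ (*-identityʳ p) (⊆-generators pU∈ pv∈ (p * 1#) (∈-scaleˡ p Uv))

open import Function using (_∘_)
open import Data.Nat as ℕ using (ℕ; zero; suc; _≤_; z≤n; s≤s; _∸_; _<?_; _≤?_)
import Data.Nat.Properties as ℕₚ
open import Data.Integer using (ℤ; +_; -[1+_]; ∣_∣)
import Data.Integer.Properties as ℤₚ
open import Data.Integer.Tactic.RingSolver using (solve-∀)
open import Data.List using ([]; _∷_; [_]; map; length)
import Data.List.Properties as List
open import Data.Fin as Fin using (Fin; zero; suc; toℕ; _↑ˡ_; punchIn; punchOut; fromℕ<)
import Data.Fin.Properties as Finₚ
open import Data.Sum as Sum using (_⊎_; inj₁; inj₂)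
open import Data.Empty using (⊥-elim)
open import Relation.Nullary using (yes; no; ¬_)
open import Relation.Binary.PropositionalEquality hiding ([_])

module Polynomials where

  open import Data.Integer using (_+_; _*_; -_)

  infix 4 _≋_

  -- _≈P_ unfolds to a function type, from which unification cannot recover the polynomials;
  -- the record keeps them inferable.
  record _≋_ (p q : Poly) : Set where
    constructor mk≋
    field coeff-≡ : p ≈P q
  open _≋_ public

  ≋-refl : ∀ {p} → p ≋ p
  ≋-refl = mk≋ λ _ → refl

  ≋-sym : ∀ {p q} → p ≋ q → q ≋ p
  ≋-sym (mk≋ e) = mk≋ (sym ∘ e)

  ≋-trans : ∀ {p q r} → p ≋ q → q ≋ r → p ≋ r
  ≋-trans (mk≋ e) (mk≋ e′) = mk≋ λ k → trans (e k) (e′ k)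

  ∷-cong : ∀ {a b p q} → a ≡ b → p ≋ q → (a ∷ p) ≋ (b ∷ q)
  ∷-cong a≡b (mk≋ e) = mk≋ λ { zero → a≡b ; (suc k) → e k }

  scale : ℤ → Poly → Poly
  scale a = map (a *_)

  -P_ : Poly → Poly
  -P_ = map -_

  coeff-+P : ∀ p q k → coeff (p +P q) k ≡ coeff p k + coeff q k
  coeff-+P []      q       k       = sym (ℤₚ.+-identityˡ _)
  coeff-+P (a ∷ p) []      k       = sym (ℤₚ.+-identityʳ _)
  coeff-+P (a ∷ p) (b ∷ q) zero    = refl
  coeff-+P (a ∷ p) (b ∷ q) (suc k) = coeff-+P p q k

  coeff-scale : ∀ a q k → coeff (scale a q) k ≡ a * coeff q k
  coeff-scale a []      k       = sym (ℤₚ.*-zeroʳ a)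
  coeff-scale a (b ∷ q) zero    = refl
  coeff-scale a (b ∷ q) (suc k) = coeff-scale a q k

  coeff-negP : ∀ q k → coeff (-P q) k ≡ - coeff q k
  coeff-negP []      k       = refl
  coeff-negP (b ∷ q) zero    = refl
  coeff-negP (b ∷ q) (suc k) = coeff-negP q k

  +P-cong : ∀ {p p′ q q′} → p ≋ p′ → q ≋ q′ → p +P q ≋ p′ +P q′
  +P-cong {p} {p′} {q} {q′} (mk≋ e) (mk≋ e′) = mk≋ λ k → begin
    coeff (p +P q) k        ≡⟨ coeff-+P p q k ⟩
    coeff p k + coeff q k   ≡⟨ cong₂ _+_ (e k) (e′ k) ⟩
    coeff p′ k + coeff q′ k ≡⟨ coeff-+P p′ q′ k ⟨
    coeff (p′ +P q′) k      ∎
    where open ≡-Reasoning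

  +P-comm : ∀ p q → p +P q ≋ q +P p
  +P-comm p q = mk≋ λ k → begin
    coeff (p +P q) k      ≡⟨ coeff-+P p q k ⟩
    coeff p k + coeff q k ≡⟨ ℤₚ.+-comm (coeff p k) _ ⟩
    coeff q k + coeff p k ≡⟨ coeff-+P q p k ⟨
    coeff (q +P p) k      ∎
    where open ≡-Reasoning

  +P-assoc : ∀ p q r → (p +P q) +P r ≋ p +P (q +P r)
  +P-assoc p q r = mk≋ λ k → begin
    coeff ((p +P q) +P r) k               ≡⟨ coeff-+P (p +P q) r k ⟩
    coeff (p +P q) k + coeff r k          ≡⟨ cong (_+ coeff r k) (coeff-+P p q k) ⟩
    coeff p k + coeff q k + coeff r k     ≡⟨ ℤₚ.+-assoc (coeff p k) _ _ ⟩
    coeff p k + (coeff q k + coeff r k)   ≡⟨ cong (_+_ (coeff p k)) (coeff-+P q r k) ⟨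
    coeff p k + coeff (q +P r) k          ≡⟨ coeff-+P p (q +P r) k ⟨
    coeff (p +P (q +P r)) k               ∎
    where open ≡-Reasoning

  +P-identityʳ : ∀ p → p +P [] ≋ p
  +P-identityʳ p = mk≋ λ k → trans (coeff-+P p [] k) (ℤₚ.+-identityʳ _)

  -P-inverseˡ : ∀ p → (-P p) +P p ≋ []
  -P-inverseˡ p = mk≋ λ k → begin
    coeff ((-P p) +P p) k        ≡⟨ coeff-+P (-P p) p k ⟩
    coeff (-P p) k + coeff p k  ≡⟨ cong (_+ coeff p k) (coeff-negP p k) ⟩
    - coeff p k + coeff p k     ≡⟨ ℤₚ.+-inverseˡ (coeff p k) ⟩
    + 0                         ∎
    where open ≡-Reasoning

  -P-cong : ∀ {p q} → p ≋ q → -P p ≋ -P q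
  -P-cong {p} {q} (mk≋ e) = mk≋ λ k → trans (coeff-negP p k) (trans (cong -_ (e k)) (sym (coeff-negP q k)))

  scale-cong : ∀ a {q q′} → q ≋ q′ → scale a q ≋ scale a q′
  scale-cong a {q} {q′} (mk≋ e) = mk≋ λ k →
    trans (coeff-scale a q k) (trans (cong (a *_) (e k)) (sym (coeff-scale a q′ k)))

  scale-+P : ∀ a p q → scale a (p +P q) ≋ scale a p +P scale a q
  scale-+P a p q = mk≋ λ k → begin
    coeff (scale a (p +P q)) k                  ≡⟨ coeff-scale a (p +P q) k ⟩
    a * coeff (p +P q) k                        ≡⟨ cong (a *_) (coeff-+P p q k) ⟩
    a * (coeff p k + coeff q k)                 ≡⟨ ℤₚ.*-distribˡ-+ a (coeff p k) _ ⟩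
    a * coeff p k + a * coeff q k               ≡⟨ cong₂ _+_ (coeff-scale a p k) (coeff-scale a q k) ⟨
    coeff (scale a p) k + coeff (scale a q) k   ≡⟨ coeff-+P (scale a p) _ k ⟨
    coeff (scale a p +P scale a q) k            ∎
    where open ≡-Reasoning

  +-scale : ∀ a b q → scale (a + b) q ≋ scale a q +P scale b q
  +-scale a b q = mk≋ λ k → begin
    coeff (scale (a + b) q) k                   ≡⟨ coeff-scale (a + b) q k ⟩
    (a + b) * coeff q k                         ≡⟨ ℤₚ.*-distribʳ-+ (coeff q k) a b ⟩
    a * coeff q k + b * coeff q k               ≡⟨ cong₂ _+_ (coeff-scale a q k) (coeff-scale b q k) ⟨
    coeff (scale a q) k + coeff (scale b q) k   ≡⟨ coeff-+P (scale a q) _ k ⟨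
    coeff (scale a q +P scale b q) k            ∎
    where open ≡-Reasoning

  scale-scale : ∀ a b q → scale a (scale b q) ≋ scale (a * b) q
  scale-scale a b q = mk≋ λ k → begin
    coeff (scale a (scale b q)) k ≡⟨ coeff-scale a (scale b q) k ⟩
    a * coeff (scale b q) k       ≡⟨ cong (a *_) (coeff-scale b q k) ⟩
    a * (b * coeff q k)           ≡⟨ ℤₚ.*-assoc a b _ ⟨
    a * b * coeff q k             ≡⟨ coeff-scale (a * b) q k ⟨
    coeff (scale (a * b) q) k     ∎
    where open ≡-Reasoning

  scale-zero : ∀ q → scale (+ 0) q ≋ []
  scale-zero q = mk≋ (coeff-scale (+ 0) q)

  scale-one : ∀ q → scale (+ 1) q ≋ q
  scale-one q = mk≋ λ k → trans (coeff-scale (+ 1) q k) (ℤₚ.*-identityˡ _)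

  +P-swap : ∀ p q r → p +P (q +P r) ≋ q +P (p +P r)
  +P-swap p q r = ≋-trans (≋-sym (+P-assoc p q r))
    (≋-trans (+P-cong (+P-comm p q) ≋-refl) (+P-assoc q p r))

  +P-interchange : ∀ p q r s → (p +P q) +P (r +P s) ≋ (p +P r) +P (q +P s)
  +P-interchange p q r s = ≋-trans (+P-assoc p q (r +P s))
    (≋-trans (+P-cong (≋-refl {p}) (+P-swap q r s)) (≋-sym (+P-assoc p r (q +P s))))

  0∷[]≋[] : (+ 0 ∷ []) ≋ []
  0∷[]≋[] = mk≋ λ { zero → refl ; (suc k) → refl }

  coeff-*P-zero : ∀ a p q → coeff ((a ∷ p) *P q) zero ≡ a * coeff q zero
  coeff-*P-zero a p q = trans (coeff-+P (scale a q) (+ 0 ∷ (p *P q)) zero)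
    (trans (cong (_+ + 0) (coeff-scale a q zero)) (ℤₚ.+-identityʳ _))

  coeff-*P-suc : ∀ a p q k → coeff ((a ∷ p) *P q) (suc k) ≡ a * coeff q (suc k) + coeff (p *P q) k
  coeff-*P-suc a p q k = trans (coeff-+P (scale a q) (+ 0 ∷ (p *P q)) (suc k))
    (cong (_+ coeff (p *P q) k) (coeff-scale a q (suc k)))

  *P-vanishˡ : ∀ p q → p ≋ [] → p *P q ≋ []
  *P-vanishˡ []      q _        = ≋-refl
  *P-vanishˡ (a ∷ p) q (mk≋ z) = mk≋ λ
    { zero    → trans (coeff-*P-zero a p q) (a≡0⇒a*b≡0 (coeff q zero))
    ; (suc k) → trans (coeff-*P-suc a p q k)
        (cong₂ _+_ (a≡0⇒a*b≡0 (coeff q (suc k))) (coeff-≡ (*P-vanishˡ p q (mk≋ (z ∘ suc))) k)) }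
    where
    a≡0⇒a*b≡0 : ∀ b → a * b ≡ + 0
    a≡0⇒a*b≡0 b = trans (cong (_* b) (z zero)) (ℤₚ.*-zeroˡ b)

  *P-congˡ : ∀ {p p′} q → p ≋ p′ → p *P q ≋ p′ *P q
  *P-congˡ {[]}    {p′}     q e       = ≋-sym (*P-vanishˡ p′ q (≋-sym e))
  *P-congˡ {a ∷ p} {[]}     q e       = *P-vanishˡ (a ∷ p) q e
  *P-congˡ {a ∷ p} {b ∷ p′} q (mk≋ e) = mk≋ λ
    { zero    → trans (coeff-*P-zero a p q)
        (trans (cong (_* coeff q zero) (e zero)) (sym (coeff-*P-zero b p′ q)))
    ; (suc k) → trans (coeff-*P-suc a p q k)
        (trans (cong₂ _+_ (cong (_* coeff q (suc k)) (e zero))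
                          (coeff-≡ (*P-congˡ {p} {p′} q (mk≋ (e ∘ suc))) k))
          (sym (coeff-*P-suc b p′ q k))) }

  *P-congʳ : ∀ p {q q′} → q ≋ q′ → p *P q ≋ p *P q′
  *P-congʳ []      e = ≋-refl
  *P-congʳ (a ∷ p) e = +P-cong (scale-cong a e) (∷-cong refl (*P-congʳ p e))

  *P-cong : ∀ {p p′ q q′} → p ≋ p′ → q ≋ q′ → p *P q ≋ p′ *P q′
  *P-cong {p′ = p′} {q} e e′ = ≋-trans (*P-congˡ q e) (*P-congʳ p′ e′)

  *P-zeroʳ : ∀ p → p *P [] ≋ []
  *P-zeroʳ []      = ≋-refl
  *P-zeroʳ (a ∷ p) = mk≋ λ { zero → refl ; (suc k) → coeff-≡ (*P-zeroʳ p) k }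

  *P-consʳ : ∀ p a q → p *P (a ∷ q) ≋ scale a p +P (+ 0 ∷ (p *P q))
  *P-consʳ []      a q = ≋-sym 0∷[]≋[]
  *P-consʳ (b ∷ p) a q = ∷-cong (cong (_+ + 0) (ℤₚ.*-comm b a))
    (≋-trans (+P-cong (≋-refl {scale b q}) (*P-consʳ p a q)) (+P-swap (scale b q) (scale a p) _))

  *P-comm : ∀ p q → p *P q ≋ q *P p
  *P-comm []      q = ≋-sym (*P-zeroʳ q)
  *P-comm (a ∷ p) q =
    ≋-trans (+P-cong (≋-refl {scale a q}) (∷-cong refl (*P-comm p q))) (≋-sym (*P-consʳ q a p))

  *P-distribʳ : ∀ p q r → (p +P q) *P r ≋ (p *P r) +P (q *P r)
  *P-distribʳ []      q       r = ≋-refl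
  *P-distribʳ (a ∷ p) []      r = ≋-sym (+P-identityʳ _)
  *P-distribʳ (a ∷ p) (b ∷ q) r =
    ≋-trans (+P-cong (+-scale a b r) (∷-cong refl (*P-distribʳ p q r)))
      (+P-interchange (scale a r) (scale b r) (+ 0 ∷ (p *P r)) (+ 0 ∷ (q *P r)))

  *P-distribˡ : ∀ p q r → p *P (q +P r) ≋ (p *P q) +P (p *P r)
  *P-distribˡ p q r = ≋-trans (*P-comm p (q +P r))
    (≋-trans (*P-distribʳ q r p) (+P-cong (*P-comm q p) (*P-comm r p)))

  scale-*P : ∀ a q r → scale a q *P r ≋ scale a (q *P r)
  scale-*P a []      r = ≋-refl
  scale-*P a (b ∷ q) r = ≋-sym (≋-trans (scale-+P a (scale b r) (+ 0 ∷ (q *P r)))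
    (+P-cong (scale-scale a b r) (∷-cong (ℤₚ.*-zeroʳ a) (≋-sym (scale-*P a q r)))))

  *P-assoc : ∀ p q r → (p *P q) *P r ≋ p *P (q *P r)
  *P-assoc []      q r = ≋-refl
  *P-assoc (a ∷ p) q r = ≋-trans (*P-distribʳ (scale a q) (+ 0 ∷ (p *P q)) r)
    (+P-cong (scale-*P a q r) (+P-cong (scale-zero r) (∷-cong refl (*P-assoc p q r))))

  const-*P : ∀ a p → const a *P p ≋ scale a p
  const-*P a p = ≋-trans (+P-cong (≋-refl {scale a p}) 0∷[]≋[]) (+P-identityʳ (scale a p))

  *P-identityˡ : ∀ p → const (+ 1) *P p ≋ p
  *P-identityˡ p = ≋-trans (const-*P (+ 1) p) (scale-one p)

  *P-identityʳ : ∀ p → p *P const (+ 1) ≋ p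
  *P-identityʳ p = ≋-trans (*P-comm p (const (+ 1))) (*P-identityˡ p)

  PolyRing : CommutativeRing 0ℓ 0ℓ
  PolyRing = record
    { Carrier = Poly ; _≈_ = _≋_ ; _+_ = _+P_ ; _*_ = _*P_ ; -_ = -P_ ; 0# = [] ; 1# = const (+ 1)
    ; isCommutativeRing = record
      { isRing = record
        { +-isAbelianGroup = record
          { isGroup = record
            { isMonoid = record
              { isSemigroup = record
                { isMagma = record
                  { isEquivalence = record { refl = ≋-refl ; sym = ≋-sym ; trans = ≋-trans }
                  ; ∙-cong = +P-cong }
                ; assoc = +P-assoc }
              ; identity = (λ _ → ≋-refl) , +P-identityʳ }
            ; inverse = -P-inverseˡ , λ p → ≋-trans (+P-comm p (-P p)) (-P-inverseˡ p)
            ; ⁻¹-cong = -P-cong }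
          ; comm = +P-comm }
        ; *-cong = *P-cong
        ; *-assoc = *P-assoc
        ; *-identity = *P-identityˡ , *P-identityʳ
        ; distrib = *P-distribˡ , λ r p q → *P-distribʳ p q r }
      ; *-comm = *P-comm } }

open Polynomials
open TwoGeneratorIdeals PolyRing

comaximal-prodPʳ : ∀ {n} u (G : Fin n → Poly) → (∀ j → Comaximal u (G j)) → Comaximal u (prodP G)
comaximal-prodPʳ {zero}  u G _  = generator-∈₂
comaximal-prodPʳ {suc n} u G uG = comaximal-*ʳ (uG zero) (comaximal-prodPʳ u (G ∘ suc) (uG ∘ suc))

comaximal-prodPˡ : ∀ {n} (F : Fin n → Poly) v → (∀ i → Comaximal (F i) v) → Comaximal (prodP F) v
comaximal-prodPˡ F v Fv = ∈-swap (comaximal-prodPʳ v F (∈-swap ∘ Fv))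

prodP-≐ : ∀ p a b c (f : Fin (a ℕ.+ b) → Poly) (g : Fin (a ℕ.+ c) → Poly) (h : Fin a → Poly) →
  (∀ i j → toℕ i ≢ toℕ j ⊎ a ≤ toℕ i → Comaximal (f i) (g j)) →
  (∀ i → ⦅ f (i ↑ˡ b) , g (i ↑ˡ c) ⦆≐⦅ p , h i ⦆) →
  ⦅ prodP f , prodP g ⦆≐⦅ p , prodP h ⦆
prodP-≐ p zero b c f g h comaximal _ = comaximal-≐ fg generator-∈₂
  where
  fg : Comaximal (prodP f) (prodP g)
  fg = comaximal-prodPˡ f (prodP g) λ i → comaximal-prodPʳ (f i) g λ j → comaximal i j (inj₂ z≤n)
prodP-≐ p (suc a) b c f g h comaximal ≐ₕ =
  ≐-* (≐ₕ zero) (prodP-≐ p a b c (f ∘ suc) (g ∘ suc) (h ∘ suc) comaximal-tail (≐ₕ ∘ suc)) uV Uv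
  where
  comaximal-tail : ∀ i j → toℕ i ≢ toℕ j ⊎ a ≤ toℕ i → Comaximal (f (suc i)) (g (suc j))
  comaximal-tail i j i≁j = comaximal (suc i) (suc j) (Sum.map (λ i≢j → i≢j ∘ ℕₚ.suc-injective) s≤s i≁j)
  uV : Comaximal (f zero) (prodP (g ∘ suc))
  uV = comaximal-prodPʳ (f zero) (g ∘ suc) λ j → comaximal zero (suc j) (inj₁ λ ())
  Uv : Comaximal (prodP (f ∘ suc)) (g zero)
  Uv = comaximal-prodPˡ (f ∘ suc) (g zero) λ i → comaximal (suc i) zero (inj₁ λ ())

module Determinants where

  open import Data.Integer using (_+_; _*_; -_)

  Matrix : ℕ → Set
  Matrix n = Fin n → Fin n → ℤ

  sign : ∀ {n} → Fin n → ℤ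
  sign i = signℤ (toℕ i)

  minor : ∀ {n} → Matrix (suc n) → Fin (suc n) → Matrix n
  minor M j r c = M (suc r) (punchIn j c)

  sumFin-cong : ∀ {n} {F G : Fin n → ℤ} → (∀ i → F i ≡ G i) → sumFin F ≡ sumFin G
  sumFin-cong {zero}  F≡G = refl
  sumFin-cong {suc n} F≡G = cong₂ _+_ (F≡G zero) (sumFin-cong (F≡G ∘ suc))

  sumFin-zero : ∀ {n} {F : Fin n → ℤ} → (∀ i → F i ≡ + 0) → sumFin F ≡ + 0
  sumFin-zero {zero}  F≡0 = refl
  sumFin-zero {suc n} F≡0 = cong₂ _+_ (F≡0 zero) (sumFin-zero (F≡0 ∘ suc))

  sumFin-neg : ∀ {n} (F : Fin n → ℤ) → sumFin (λ i → - F i) ≡ - sumFin F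
  sumFin-neg {zero}  F = refl
  sumFin-neg {suc n} F = trans (cong (_+_ (- F zero)) (sumFin-neg (F ∘ suc)))
    (sym (ℤₚ.neg-distrib-+ (F zero) _))

  sumFin-*ˡ : ∀ {n} a (F : Fin n → ℤ) → sumFin (λ i → a * F i) ≡ a * sumFin F
  sumFin-*ˡ {zero}  a F = sym (ℤₚ.*-zeroʳ a)
  sumFin-*ˡ {suc n} a F = trans (cong (_+_ (a * F zero)) (sumFin-*ˡ a (F ∘ suc)))
    (sym (ℤₚ.*-distribˡ-+ a (F zero) _))

  sumFin-+ : ∀ {n} (F G : Fin n → ℤ) → sumFin (λ i → F i + G i) ≡ sumFin F + sumFin G
  sumFin-+ {zero}  F G = refl
  sumFin-+ {suc n} F G = trans (cong (_+_ (F zero + G zero)) (sumFin-+ (F ∘ suc) (G ∘ suc)))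
    (interchange (F zero) (G zero) (sumFin (F ∘ suc)) (sumFin (G ∘ suc)))
    where
    interchange : ∀ a b c d → a + b + (c + d) ≡ a + c + (b + d)
    interchange = solve-∀

  sumFin-swap : ∀ {m n} (F : Fin m → Fin n → ℤ) →
    sumFin (λ i → sumFin (F i)) ≡ sumFin (λ j → sumFin (λ i → F i j))
  sumFin-swap {zero} {n} F = sym (sumFin-zero {n} (λ _ → refl))
  sumFin-swap {suc m} F = trans (cong (_+_ (sumFin (F zero))) (sumFin-swap (F ∘ suc)))
    (sym (sumFin-+ (F zero) (λ j → sumFin (λ i → F (suc i) j))))

  sumFin-punchIn : ∀ {n} (a : Fin (suc n)) (F : Fin (suc n) → ℤ) → sumFin F ≡ F a + sumFin (F ∘ punchIn a)
  sumFin-punchIn         zero    F = refl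
  sumFin-punchIn {suc n} (suc a) F = trans (cong (_+_ (F zero)) (sumFin-punchIn a (F ∘ suc)))
    (swap (F zero) (F (suc a)) _)
    where
    swap : ∀ x y z → x + (y + z) ≡ y + (x + z)
    swap = solve-∀

  det-cong : ∀ {n} {M M′ : Matrix n} → (∀ r c → M r c ≡ M′ r c) → det M ≡ det M′
  det-cong {zero}  M≡M′ = refl
  det-cong {suc n} M≡M′ = sumFin-cong λ j →
    cong₂ (λ x d → sign j * (x * d)) (M≡M′ zero j) (det-cong (λ r c → M≡M′ (suc r) (punchIn j c)))

  signℤ-suc : ∀ m → signℤ (suc m) ≡ - signℤ m
  signℤ-suc zero    = refl
  signℤ-suc (suc m) = trans (sym (ℤₚ.neg-involutive (signℤ m))) (cong -_ (sym (signℤ-suc m)))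

  -- Deleting columns a and b in either order leaves the same columns, with opposite signs.
  punchIn-punchOut-comm : ∀ {n} {a b : Fin (suc (suc n))} (a≢b : a ≢ b) (b≢a : b ≢ a) (c : Fin n) →
    punchIn a (punchIn (punchOut a≢b) c) ≡ punchIn b (punchIn (punchOut b≢a) c)
  punchIn-punchOut-comm {a = zero}  {zero}  a≢b _ c = ⊥-elim (a≢b refl)
  punchIn-punchOut-comm {a = zero}  {suc b} _   _ c = refl
  punchIn-punchOut-comm {a = suc a} {zero}  _   _ c = refl
  punchIn-punchOut-comm {suc n} {suc a} {suc b} a≢b b≢a zero    = refl
  punchIn-punchOut-comm {suc n} {suc a} {suc b} a≢b b≢a (suc c) =
    cong suc (punchIn-punchOut-comm (a≢b ∘ cong suc) (b≢a ∘ cong suc) c)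

  sign-punchOut : ∀ {n} {a b : Fin (suc (suc n))} (a≢b : a ≢ b) (b≢a : b ≢ a) →
    sign a * sign (punchOut a≢b) ≡ - (sign b * sign (punchOut b≢a))
  sign-punchOut {a = zero}  {zero}  a≢b _ = ⊥-elim (a≢b refl)
  sign-punchOut {a = zero}  {suc b} _   _ = begin
    + 1 * sign b                ≡⟨ ℤₚ.*-identityˡ (sign b) ⟩
    sign b                      ≡⟨ ℤₚ.neg-involutive (sign b) ⟨
    - - sign b                  ≡⟨ cong -_ (signℤ-suc (toℕ b)) ⟨
    - sign (suc b)              ≡⟨ cong -_ (ℤₚ.*-identityʳ (sign (suc b))) ⟨
    - (sign (suc b) * + 1)      ∎
    where open ≡-Reasoning
  sign-punchOut {a = suc a} {zero}  _   _ = begin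
    sign (suc a) * + 1 ≡⟨ ℤₚ.*-identityʳ (sign (suc a)) ⟩
    sign (suc a)       ≡⟨ signℤ-suc (toℕ a) ⟩
    - sign a           ≡⟨ cong -_ (ℤₚ.*-identityˡ (sign a)) ⟨
    - (+ 1 * sign a)   ∎
    where open ≡-Reasoning
  sign-punchOut {zero}  {suc zero} {suc zero} a≢b _ = ⊥-elim (a≢b refl)
  sign-punchOut {suc n} {suc a}    {suc b}    a≢b b≢a = begin
    sign (suc a) * sign (suc a′)       ≡⟨ cong₂ _*_ (signℤ-suc (toℕ a)) (signℤ-suc (toℕ a′)) ⟩
    - sign a * - sign a′               ≡⟨ neg-*-neg (sign a) (sign a′) ⟩
    sign a * sign a′                   ≡⟨ sign-punchOut (a≢b ∘ cong suc) (b≢a ∘ cong suc) ⟩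
    - (sign b * sign b′)               ≡⟨ cong -_ (neg-*-neg (sign b) (sign b′)) ⟨
    - (- sign b * - sign b′)           ≡⟨ cong -_ (cong₂ _*_ (signℤ-suc (toℕ b)) (signℤ-suc (toℕ b′))) ⟨
    - (sign (suc b) * sign (suc b′))   ∎
    where
    open ≡-Reasoning
    a′ = punchOut (a≢b ∘ cong suc)
    b′ = punchOut (b≢a ∘ cong suc)
    neg-*-neg : ∀ x y → - x * - y ≡ x * y
    neg-*-neg = solve-∀

  swapTopRows : ∀ {n} → Matrix (suc (suc n)) → Matrix (suc (suc n))
  swapTopRows M zero          = M (suc zero)
  swapTopRows M (suc zero)    = M zero
  swapTopRows M (suc (suc r)) = M (suc (suc r))

  module _ {n : ℕ} where

    -- The summand of the expansion of det M along its first two rows that involves M₀ₐ M₁ᵦ.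
    twoRowTerm : Matrix (suc (suc n)) → Fin (suc (suc n)) → Fin (suc (suc n)) → ℤ
    twoRowTerm M a b with a Fin.≟ b
    ... | yes _   = + 0
    ... | no  a≢b = (sign a * M zero a) * (sign (punchOut a≢b) * (M (suc zero) b *
                    det (λ r c → M (suc (suc r)) (punchIn a (punchIn (punchOut a≢b) c)))))

    det≡sum-twoRowTerm : ∀ M → det M ≡ sumFin (λ a → sumFin (twoRowTerm M a))
    det≡sum-twoRowTerm M = sumFin-cong λ a → begin
      sign a * (M zero a * det (minor M a))
        ≡⟨ ℤₚ.*-assoc (sign a) (M zero a) _ ⟨
      sign a * M zero a * det (minor M a)
        ≡⟨ sumFin-*ˡ (sign a * M zero a)
                     (λ k → sign k * (M (suc zero) (punchIn a k) * det (minor (minor M a) k))) ⟨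
      sumFin (λ k → sign a * M zero a * (sign k * (M (suc zero) (punchIn a k) * det (minor (minor M a) k))))
        ≡⟨ sumFin-cong (λ k → sym (twoRowTerm-punchIn a k)) ⟩
      sumFin (twoRowTerm M a ∘ punchIn a)
        ≡⟨ ℤₚ.+-identityˡ _ ⟨
      + 0 + sumFin (twoRowTerm M a ∘ punchIn a)
        ≡⟨ cong (_+ sumFin (twoRowTerm M a ∘ punchIn a)) (twoRowTerm-diagonal a) ⟨
      twoRowTerm M a a + sumFin (twoRowTerm M a ∘ punchIn a)
        ≡⟨ sumFin-punchIn a (twoRowTerm M a) ⟨
      sumFin (twoRowTerm M a) ∎
      where
      open ≡-Reasoning
      twoRowTerm-diagonal : ∀ a → twoRowTerm M a a ≡ + 0
      twoRowTerm-diagonal a with a Fin.≟ a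
      ... | yes _   = refl
      ... | no  a≢a = ⊥-elim (a≢a refl)
      twoRowTerm-punchIn : ∀ a k → twoRowTerm M a (punchIn a k) ≡
        sign a * M zero a * (sign k * (M (suc zero) (punchIn a k) * det (minor (minor M a) k)))
      twoRowTerm-punchIn a k with a Fin.≟ punchIn a k
      ... | yes a≡ = ⊥-elim (Finₚ.punchInᵢ≢i a k (sym a≡))
      ... | no  a≢ rewrite trans (Finₚ.punchOut-cong a {i≢j = a≢} refl) (Finₚ.punchOut-punchIn a) = refl

    twoRowTerm-swapTopRows : ∀ M a b → twoRowTerm (swapTopRows M) a b ≡ - twoRowTerm M b a
    twoRowTerm-swapTopRows M a b with a Fin.≟ b | b Fin.≟ a
    ... | yes _   | yes _   = refl
    ... | yes a≡b | no  b≢a = ⊥-elim (b≢a (sym a≡b))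
    ... | no  a≢b | yes b≡a = ⊥-elim (a≢b (sym b≡a))
    ... | no  a≢b | no  b≢a = begin
      (sign a * M (suc zero) a) * (sign (punchOut a≢b) * (M zero b * Dₐ))
        ≡⟨ cong (λ d → (sign a * M (suc zero) a) * (sign (punchOut a≢b) * (M zero b * d))) Dₐ≡Dᵦ ⟩
      (sign a * M (suc zero) a) * (sign (punchOut a≢b) * (M zero b * Dᵦ))
        ≡⟨ regroup (sign a) (sign (punchOut a≢b)) (M (suc zero) a) (M zero b) Dᵦ ⟩
      (sign a * sign (punchOut a≢b)) * (M zero b * M (suc zero) a * Dᵦ)
        ≡⟨ cong (_* (M zero b * M (suc zero) a * Dᵦ)) (sign-punchOut a≢b b≢a) ⟩
      - (sign b * sign (punchOut b≢a)) * (M zero b * M (suc zero) a * Dᵦ)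
        ≡⟨ regroup-neg (sign b) (sign (punchOut b≢a)) (M zero b) (M (suc zero) a) Dᵦ ⟩
      - ((sign b * M zero b) * (sign (punchOut b≢a) * (M (suc zero) a * Dᵦ))) ∎
      where
      open ≡-Reasoning
      Dₐ = det (λ r c → M (suc (suc r)) (punchIn a (punchIn (punchOut a≢b) c)))
      Dᵦ = det (λ r c → M (suc (suc r)) (punchIn b (punchIn (punchOut b≢a) c)))
      Dₐ≡Dᵦ : Dₐ ≡ Dᵦ
      Dₐ≡Dᵦ = det-cong λ r c → cong (M (suc (suc r))) (punchIn-punchOut-comm a≢b b≢a c)
      regroup : ∀ x y A B D → (x * A) * (y * (B * D)) ≡ (x * y) * (B * A * D)
      regroup = solve-∀
      regroup-neg : ∀ x y A B D → - (x * y) * (A * B * D) ≡ - ((x * A) * (y * (B * D)))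
      regroup-neg = solve-∀

    det-swapTopRows : ∀ M → det (swapTopRows M) ≡ - det M
    det-swapTopRows M = begin
      det (swapTopRows M)
        ≡⟨ det≡sum-twoRowTerm (swapTopRows M) ⟩
      sumFin (λ a → sumFin (twoRowTerm (swapTopRows M) a))
        ≡⟨ sumFin-cong (λ a → sumFin-cong (twoRowTerm-swapTopRows M a)) ⟩
      sumFin (λ a → sumFin (λ b → - twoRowTerm M b a))
        ≡⟨ sumFin-cong (λ a → sumFin-neg (λ b → twoRowTerm M b a)) ⟩
      sumFin (λ a → - sumFin (λ b → twoRowTerm M b a))
        ≡⟨ sumFin-neg (λ a → sumFin (λ b → twoRowTerm M b a)) ⟩
      - sumFin (λ a → sumFin (λ b → twoRowTerm M b a))
        ≡⟨ cong -_ (sumFin-swap (twoRowTerm M)) ⟨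
      - sumFin (λ b → sumFin (twoRowTerm M b))
        ≡⟨ cong -_ (det≡sum-twoRowTerm M) ⟨
      - det M ∎
      where open ≡-Reasoning

  x≡-x⇒x≡0 : ∀ {x} → x ≡ - x → x ≡ + 0
  x≡-x⇒x≡0 {+ zero}    _  = refl
  x≡-x⇒x≡0 {+ suc n}   ()
  x≡-x⇒x≡0 { -[1+ n ]} ()

  det-minors-zero : ∀ {n} (M : Matrix (suc n)) → (∀ j → det (minor M j) ≡ + 0) → det M ≡ + 0
  det-minors-zero M minor≡0 = sumFin-zero λ j →
    trans (cong (λ d → sign j * (M zero j * d)) (minor≡0 j))
          (trans (cong (sign j *_) (ℤₚ.*-zeroʳ (M zero j))) (ℤₚ.*-zeroʳ (sign j)))

  -- Swapping the top rows moves the repeated row into a minor one size down.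
  det-row₀-repeated : ∀ {n} (M : Matrix (suc n)) (j : Fin n) → (∀ c → M zero c ≡ M (suc j) c) → det M ≡ + 0
  det-row₀-repeated {suc n} M zero row₀≡ = x≡-x⇒x≡0 (trans (det-cong M≡swapped) (det-swapTopRows M))
    where
    M≡swapped : ∀ r c → M r c ≡ swapTopRows M r c
    M≡swapped zero          c = row₀≡ c
    M≡swapped (suc zero)    c = sym (row₀≡ c)
    M≡swapped (suc (suc r)) c = refl
  det-row₀-repeated {suc n} M (suc k) row₀≡ = begin
    det M                     ≡⟨ ℤₚ.neg-involutive (det M) ⟨
    - - det M                 ≡⟨ cong -_ (det-swapTopRows M) ⟨
    - det (swapTopRows M)     ≡⟨ cong -_ (det-minors-zero (swapTopRows M) minor≡0) ⟩
    + 0                       ∎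
    where
    open ≡-Reasoning
    minor≡0 : ∀ a → det (minor (swapTopRows M) a) ≡ + 0
    minor≡0 a = det-row₀-repeated (minor (swapTopRows M) a) k (row₀≡ ∘ punchIn a)

  cofactor : ∀ {n} → Matrix (suc n) → Fin (suc n) → ℤ
  cofactor M j = sign j * det (minor M j)

  withRow₀ : ∀ {n} → (Fin n → ℤ) → Matrix n → Matrix n
  withRow₀ v M zero    = v
  withRow₀ v M (suc r) = M (suc r)

  det-withRow₀ : ∀ {n} (v : Fin (suc n) → ℤ) (M : Matrix (suc n)) →
    det (withRow₀ v M) ≡ sumFin (λ j → v j * cofactor M j)
  det-withRow₀ v M = sumFin-cong λ j → swap (sign j) (v j) (det (minor M j))
    where
    swap : ∀ s x d → s * (x * d) ≡ x * (s * d)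
    swap = solve-∀

  cofactor-expansion : ∀ {n} (M : Matrix (suc n)) → sumFin (λ j → M zero j * cofactor M j) ≡ det M
  cofactor-expansion M = trans (sym (det-withRow₀ (M zero) M)) (det-cong row≡)
    where
    row≡ : ∀ r c → withRow₀ (M zero) M r c ≡ M r c
    row≡ zero    c = refl
    row≡ (suc r) c = refl

  alien-cofactor-expansion : ∀ {n} (M : Matrix (suc n)) (r : Fin n) →
    sumFin (λ j → M (suc r) j * cofactor M j) ≡ + 0
  alien-cofactor-expansion M r =
    trans (sym (det-withRow₀ (M (suc r)) M)) (det-row₀-repeated (withRow₀ (M (suc r)) M) r (λ _ → refl))

open Determinants

module Resultants where

  open import Data.Integer using (_+_; _*_)

  shift : ℕ → Poly → Poly
  shift zero    p = p
  shift (suc k) p = + 0 ∷ shift k p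

  shift-≋-*P : ∀ k p → shift k p ≋ shift k (const (+ 1)) *P p
  shift-≋-*P zero    p = ≋-sym (*P-identityˡ p)
  shift-≋-*P (suc k) p = ≋-trans (∷-cong refl (shift-≋-*P k p)) (≋-sym (+P-cong (scale-zero p) ≋-refl))

  coeff-shift : ∀ k p r → coeff (shift k p) r ≡ shiftCoeff p k r
  coeff-shift k p r with k ≤? r
  ... | yes k≤r = below k r k≤r
    where
    below : ∀ k r → k ≤ r → coeff (shift k p) r ≡ coeff p (r ∸ k)
    below zero    r       _         = refl
    below (suc k) (suc r) (s≤s k≤r) = below k r k≤r
  ... | no  k≰r = above k r k≰r
    where
    above : ∀ k r → ¬ k ≤ r → coeff (shift k p) r ≡ + 0
    above zero    r       k≰r = ⊥-elim (k≰r z≤n)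
    above (suc k) zero    _   = refl
    above (suc k) (suc r) k≰r = above k r (k≰r ∘ s≤s)

  length-shift : ∀ k p → length (shift k p) ≡ k ℕ.+ length p
  length-shift zero    p = refl
  length-shift (suc k) p = cong suc (length-shift k p)

  coeff-beyond-length : ∀ p {r} → length p ≤ r → coeff p r ≡ + 0
  coeff-beyond-length []      _         = refl
  coeff-beyond-length (a ∷ p) (s≤s p≤r) = coeff-beyond-length p p≤r

  length-monic : ∀ {p} → Monic p → length p ≡ suc (deg p)
  length-monic (xs , refl) rewrite List.length-++ xs {[ + 1 ]} | ℕₚ.+-comm (length xs) 1 = refl

  monic-deg0 : ∀ {p} → Monic p → deg p ≡ 0 → p ≋ const (+ 1)
  monic-deg0 ([]     , refl) _     = ≋-refl
  monic-deg0 (x ∷ xs , refl) deg≡0 with ℕₚ.m+n≡0⇒n≡0 (length xs) (trans (sym (List.length-++ xs)) deg≡0)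
  ... | ()

  sylvesterColumn : (f g : Poly) → Fin (deg f ℕ.+ deg g) → Poly
  sylvesterColumn f g c with toℕ c <? deg g
  ... | yes _ = shift (toℕ c) f
  ... | no  _ = shift (toℕ c ∸ deg g) g

  sylvesterColumn-∈ : ∀ f g c → sylvesterColumn f g c ∈⦅ f , g ⦆
  sylvesterColumn-∈ f g c with toℕ c <? deg g
  ... | yes _ = ∈-resp-≈ (≋-sym (shift-≋-*P (toℕ c) f)) (multiple-∈₁ (shift (toℕ c) (const (+ 1))))
  ... | no  _ = ∈-resp-≈ (≋-sym (shift-≋-*P (toℕ c ∸ deg g) g))
                         (multiple-∈₂ (shift (toℕ c ∸ deg g) (const (+ 1))))

  coeff-sylvesterColumn : ∀ f g r c → coeff (sylvesterColumn f g c) (toℕ r) ≡ sylvester f g r c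
  coeff-sylvesterColumn f g r c with toℕ c <? deg g
  ... | yes _ = coeff-shift (toℕ c) f (toℕ r)
  ... | no  _ = coeff-shift (toℕ c ∸ deg g) g (toℕ r)

  sylvesterColumn-degree : ∀ {f g} → Monic f → Monic g → ∀ c {k} → deg f ℕ.+ deg g ≤ k →
    coeff (sylvesterColumn f g c) k ≡ + 0
  sylvesterColumn-degree {f} {g} mf mg c {k} n≤k with toℕ c <? deg g
  ... | yes c<m = coeff-beyond-length (shift (toℕ c) f) (begin
    length (shift (toℕ c) f)  ≡⟨ length-shift (toℕ c) f ⟩
    toℕ c ℕ.+ length f        ≡⟨ cong (toℕ c ℕ.+_) (length-monic mf) ⟩
    toℕ c ℕ.+ suc (deg f)     ≡⟨ ℕₚ.+-suc (toℕ c) (deg f) ⟩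
    suc (toℕ c) ℕ.+ deg f     ≤⟨ ℕₚ.+-monoˡ-≤ (deg f) c<m ⟩
    deg g ℕ.+ deg f           ≡⟨ ℕₚ.+-comm (deg g) (deg f) ⟩
    deg f ℕ.+ deg g           ≤⟨ n≤k ⟩
    k                         ∎)
    where open ℕₚ.≤-Reasoning
  ... | no  c≮m = coeff-beyond-length (shift (toℕ c ∸ deg g) g) (begin
    length (shift (toℕ c ∸ deg g) g)      ≡⟨ length-shift (toℕ c ∸ deg g) g ⟩
    (toℕ c ∸ deg g) ℕ.+ length g          ≡⟨ cong ((toℕ c ∸ deg g) ℕ.+_) (length-monic mg) ⟩
    (toℕ c ∸ deg g) ℕ.+ suc (deg g)       ≡⟨ ℕₚ.+-suc (toℕ c ∸ deg g) (deg g) ⟩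
    suc ((toℕ c ∸ deg g) ℕ.+ deg g)       ≡⟨ cong suc (ℕₚ.m∸n+n≡m (ℕₚ.≮⇒≥ c≮m)) ⟩
    suc (toℕ c)                           ≤⟨ Finₚ.toℕ<n c ⟩
    deg f ℕ.+ deg g                       ≤⟨ n≤k ⟩
    k                                     ∎)
    where open ℕₚ.≤-Reasoning

  sumP : ∀ {n} → (Fin n → Poly) → Poly
  sumP {zero}  F = []
  sumP {suc n} F = F zero +P sumP (F ∘ suc)

  coeff-sumP : ∀ {n} (F : Fin n → Poly) k → coeff (sumP F) k ≡ sumFin (λ i → coeff (F i) k)
  coeff-sumP {zero}  F k = refl
  coeff-sumP {suc n} F k = trans (coeff-+P (F zero) (sumP (F ∘ suc)) k)
    (cong (_+_ (coeff (F zero) k)) (coeff-sumP (F ∘ suc) k))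

  ∈-sumP : ∀ {n u v} (F : Fin n → Poly) → (∀ i → F i ∈⦅ u , v ⦆) → sumP F ∈⦅ u , v ⦆
  ∈-sumP {zero}  F _   = multiple-∈₁ []
  ∈-sumP {suc n} F F∈ = ∈-+ (F∈ zero) (∈-sumP (F ∘ suc) (F∈ ∘ suc))

  -- Σ_c cofactor(M, c) · P c is the constant det M: at x^0 its coefficient is the cofactor
  -- expansion of det M along row 0, at x^k for 0 < k < N an expansion with alien cofactors,
  -- and beyond that every P c vanishes.
  det-∈ : ∀ {f g N} (M : Matrix N) (P : Fin N → Poly) → (N ≡ 0 → Comaximal f g) →
    (∀ c → P c ∈⦅ f , g ⦆) → (∀ r c → coeff (P c) (toℕ r) ≡ M r c) →
    (∀ c {k} → N ≤ k → coeff (P c) k ≡ + 0) → const (det M) ∈⦅ f , g ⦆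
  det-∈ {N = zero}  M P fg _  _   _     = fg refl
  det-∈ {N = suc n} M P _  P∈ P≡M P-deg =
    ∈-resp-≈ (mk≋ coeff≡) (∈-sumP Σ-term λ c → ∈-*ˡ (const (cofactor M c)) (P∈ c))
    where
    Σ-term : Fin (suc n) → Poly
    Σ-term c = const (cofactor M c) *P P c
    coeff-Σ : ∀ k → coeff (sumP Σ-term) k ≡ sumFin (λ c → coeff (P c) k * cofactor M c)
    coeff-Σ k = trans (coeff-sumP Σ-term k) (sumFin-cong λ c →
      trans (coeff-≡ (const-*P (cofactor M c) (P c)) k)
            (trans (coeff-scale (cofactor M c) (P c) k) (ℤₚ.*-comm (cofactor M c) _)))
    coeff≡ : ∀ k → coeff (sumP Σ-term) k ≡ coeff (const (det M)) k
    coeff≡ zero = trans (coeff-Σ zero)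
      (trans (sumFin-cong λ c → cong (_* cofactor M c) (P≡M zero c)) (cofactor-expansion M))
    coeff≡ (suc k) with k <? n
    ... | yes k<n = trans (coeff-Σ (suc k))
      (trans (sumFin-cong λ c → cong (_* cofactor M c) (coeff-row c))
             (alien-cofactor-expansion M (fromℕ< k<n)))
      where
      coeff-row : ∀ c → coeff (P c) (suc k) ≡ M (suc (fromℕ< k<n)) c
      coeff-row c = trans (cong (coeff (P c) ∘ suc) (sym (Finₚ.toℕ-fromℕ< k<n)))
                          (P≡M (suc (fromℕ< k<n)) c)
    ... | no  k≮n = trans (coeff-Σ (suc k)) (sumFin-zero λ c →
      trans (cong (_* cofactor M c) (P-deg c (s≤s (ℕₚ.≮⇒≥ k≮n)))) (ℤₚ.*-zeroˡ (cofactor M c)))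

  resultant-∈ : ∀ {f g} → Monic f → Monic g → const (resultant f g) ∈⦅ f , g ⦆
  resultant-∈ {f} {g} mf mg = det-∈ (sylvester f g) (sylvesterColumn f g) degrees≡0
    (sylvesterColumn-∈ f g) (coeff-sylvesterColumn f g) (sylvesterColumn-degree mf mg)
    where
    degrees≡0 : deg f ℕ.+ deg g ≡ 0 → Comaximal f g
    degrees≡0 n≡0 = ∈-resp-≈ (monic-deg0 mf (ℕₚ.m+n≡0⇒m≡0 (deg f) n≡0)) generator-∈₁

  ∣i∣≡1⇒i≡±1 : ∀ {i} → ∣ i ∣ ≡ 1 → i ≡ + 1 ⊎ i ≡ -[1+ 0 ]
  ∣i∣≡1⇒i≡±1 {+ 1}      _ = inj₁ refl
  ∣i∣≡1⇒i≡±1 { -[1+ 0 ]} _ = inj₂ refl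

  comaximal-resultant : ∀ {f g} → Monic f → Monic g → ∣ resultant f g ∣ ≡ 1 → Comaximal f g
  comaximal-resultant {f} {g} mf mg ∣R∣≡1 with ∣i∣≡1⇒i≡±1 ∣R∣≡1
  ... | inj₁ R≡1  = subst (λ r → const r ∈⦅ f , g ⦆) R≡1 (resultant-∈ mf mg)
  ... | inj₂ R≡-1 = ∈-resp-≈ (mk≋ λ { zero → refl ; (suc _) → refl })
    (∈-*ˡ (const -[1+ 0 ]) (subst (λ r → const r ∈⦅ f , g ⦆) R≡-1 (resultant-∈ mf mg)))

open Resultants

∈⦅⦆⇒∈⟨⟩ : ∀ {x u v} → x ∈⦅ u , v ⦆ → x ∈⟨ u , v ⟩
∈⦅⦆⇒∈⟨⟩ (s , t , eq) = s , t , coeff-≡ eq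

∈⟨⟩⇒∈⦅⦆ : ∀ {x u v} → x ∈⟨ u , v ⟩ → x ∈⦅ u , v ⦆
∈⟨⟩⇒∈⦅⦆ (s , t , eq) = s , t , mk≋ eq

≐⇒IdealEq : ∀ {u v u′ v′} → ⦅ u , v ⦆≐⦅ u′ , v′ ⦆ → IdealEq u v u′ v′
≐⇒IdealEq (⊆ , ⊇) = (λ x → ∈⦅⦆⇒∈⟨⟩ ∘ ⊆ x ∘ ∈⟨⟩⇒∈⦅⦆) , (λ x → ∈⦅⦆⇒∈⟨⟩ ∘ ⊇ x ∘ ∈⟨⟩⇒∈⦅⦆)

IdealEq⇒≐ : ∀ {u v u′ v′} → IdealEq u v u′ v′ → ⦅ u , v ⦆≐⦅ u′ , v′ ⦆
IdealEq⇒≐ (⊆ , ⊇) = (λ x → ∈⟨⟩⇒∈⦅⦆ ∘ ⊆ x ∘ ∈⦅⦆⇒∈⟨⟩) , (λ x → ∈⟨⟩⇒∈⦅⦆ ∘ ⊇ x ∘ ∈⦅⦆⇒∈⟨⟩)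

open import Data.Nat using (_+_)
open import Data.Nat.Primality using (Prime)

lemma2p5 : (p : ℕ) → Prime p → (a b c : ℕ) → 1 ≤ a →
    (f : Fin (a + b) → Poly) → (g : Fin (a + c) → Poly) →
    (∀ i → Monic (f i)) → (∀ j → Monic (g j)) →
    (∀ (i : Fin (a + b)) (j : Fin (a + c)) → (toℕ i ≢ toℕ j ⊎ a ≤ toℕ i) →
      ∣ resultant (f i) (g j) ∣ ≡ 1) →
    (∀ (i : Fin a) → IdealEq (f (i ↑ˡ b)) (g (i ↑ˡ c))
      (const (+ p)) (chooseH (f (i ↑ˡ b)) (g (i ↑ˡ c)))) →
    IdealEq (prodP f) (prodP g)
      (const (+ p)) (prodP (λ (i : Fin a) → chooseH (f (i ↑ˡ b)) (g (i ↑ˡ c))))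
lemma2p5 p _ a b c _ f g mf mg ∣R∣≡1 ≐ₕ = ≐⇒IdealEq
  (prodP-≐ (const (+ p)) a b c f g _ (λ i j i≁j → comaximal-resultant (mf i) (mg j) (∣R∣≡1 i j i≁j))
    (IdealEq⇒≐ ∘ ≐ₕ))
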